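{- Let $\Gamma=(V,E)$ be a finite reflexive graph and let $k\ge 1$ be an integer with $|V|\ge 2k-1$. Then $\kappa_k(\Gamma)=\kappa_{ -k}(\Gamma)$.
   Context: A graph is a pair $\Gamma=(V,E)$ with $E\subset V\times V$; it is reflexive if $(x,x)\in E$ for all $x\in V$. For $x\in V$, $\Gamma(x)=\{y:(x,y)\in E\}$ and $\Gamma(A)=\bigcup_{x\in A}\Gamma(x)$. The reverse graph is $\Gamma^{ -1}=(V,E^{ -1})$ with $E^{ -1}=\{(x,y):(y,x)\in E\}$. The boundary is $\partial(X)=\Gamma(X)\setminus X$, and $X^{\curlywedge}=V\setminus(X\cup\Gamma(X))$. A subset $X$ induces a $k$-separation if $k\le\min(|X|,|X^{\curlywedge}|)<\infty$; $\Gamma$ is $k$-separable if some subset induces a $k$-separation. For a locally finite (every $\Gamma(x)$ finite) reflexive $k$-separable graph, $\kappa_k(\Gamma)=\min\{|\partial(X)| : X \text{ finite}, |X|\ge k, |V\setminus\Gamma(X)|\ge k\}$. By convention, if $\Gamma$ is not $k$-separable and $|V|\ge 2k-1$ (so $V$ is finite), $\kappa_k(\Gamma)=|V|-2k+1$. Finally $\kappa_{ -k}(\Gamma)=\kappa_k(\Gamma^{ -1})$. -}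

module Defs where

open import Data.Bool using (Bool; true; false; _∧_; if_then_else_)
open import Data.Nat using (ℕ; zero; suc; _+_; _*_; _∸_; _⊓_; _≤ᵇ_)
open import Data.Fin using (Fin)
open import Data.Fin.Subset using (Subset; ∁; _∪_; _─_; ∣_∣)
open import Data.Vec using (Vec; []; _∷_; tabulate; lookup)
open import Data.List using (List; []; _∷_; [_]; map; _++_; foldr; filter; allFin)
open import Data.Bool.ListAction using (any)
open import Data.Bool using (T)
open import Relation.Nullary.Decidable using (T?)
open import Relation.Binary.PropositionalEquality using (_≡_)

-- A graph on the finite vertex set V = Fin n, given by its edge relation
-- (decidable, as a Bool-valued adjacency): (x , y) ∈ E  iff  E x y ≡ true.
Graph : ℕ → Set
Graph n = Fin n → Fin n → Bool

Reflexive : ∀ {n} → Graph n → Set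
Reflexive {n} E = (x : Fin n) → E x x ≡ true

rev : ∀ {n} → Graph n → Graph n
rev E x y = E y x

nbhd : ∀ {n} → Graph n → Subset n → Subset n
nbhd {n} E A = tabulate λ y → any (λ x → lookup A x ∧ E x y) (allFin n)

boundary : ∀ {n} → Graph n → Subset n → Subset n
boundary E X = nbhd E X ─ X

opp : ∀ {n} → Graph n → Subset n → Subset n
opp E X = ∁ (X ∪ nbhd E X)

subsets : (n : ℕ) → List (Subset n)
subsets zero = [ [] ]
subsets (suc n) = map (true ∷_) (subsets n) ++ map (false ∷_) (subsets n)

-- X induces a k-separation: k ≤ min(|X|, |X^⋏|)  (finiteness automatic)
inducesSep : ∀ {n} → Graph n → ℕ → Subset n → Bool
inducesSep E k X = (k ≤ᵇ ∣ X ∣) ∧ (k ≤ᵇ ∣ opp E X ∣)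

separable : ∀ {n} → Graph n → ℕ → Bool
separable {n} E k = any (inducesSep E k) (subsets n)

admissible : ∀ {n} → Graph n → ℕ → Subset n → Bool
admissible E k X = (k ≤ᵇ ∣ X ∣) ∧ (k ≤ᵇ ∣ ∁ (nbhd E X) ∣)

-- minimum of a list of naturals (only used on nonempty lists)
minList : List ℕ → ℕ
minList [] = 0
minList (x ∷ xs) = foldr _⊓_ x xs

-- κ_k(Γ): min |∂X| over admissible X if Γ is k-separable,
-- otherwise |V| - 2k + 1 (the convention, used when |V| ≥ 2k - 1)
kappa : ∀ {n} → Graph n → ℕ → ℕ
kappa {n} E k =
  if separable E k
  then minList (map (λ X → ∣ boundary E X ∣) (filter (λ X → T? (admissible E k X)) (subsets n)))
  else (n + 1) ∸ (2 * k)

kappaNeg : ∀ {n} → Graph n → ℕ → ℕ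
kappaNeg E k = kappa (rev E) k

-- For X admissible in Γ put Y = V ∖ Γ(X). Then |Y| ≥ k, and X misses Γ⁻¹(Y) (an edge from
-- x ∈ X into Y would put its endpoint in Γ(X)), so |V ∖ Γ⁻¹(Y)| ≥ |X| ≥ k: Y is admissible
-- in Γ⁻¹. Moreover Γ⁻¹(Y) ∖ Y ⊆ Γ(X) ∖ X, so Y has no larger boundary. Hence κ_{-k} ≤ κ_k,
-- and applying this to Γ⁻¹ gives equality. For a reflexive graph X ∪ Γ(X) = Γ(X), so being
-- k-separable just means having an admissible set, and Γ, Γ⁻¹ are k-separable together.
module Submission where

open import Defs
open import Data.Nat using (ℕ; _≤_; _*_; _∸_)
open import Relation.Binary.PropositionalEquality using (_≡_)

open import Data.Bool using (Bool; true; false; T; _∧_)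
open import Data.Bool.Properties using (T-≡; T-∧)
open import Data.Empty using (⊥-elim)
open import Data.Fin using (Fin)
open import Data.Fin.Subset using (Subset; _∈_; _∉_; _⊆_; ∁; _∪_; _─_; ∣_∣)
open import Data.Fin.Subset.Properties
  using (p⊆q⇒∣p∣≤∣q∣; ⊆-antisym; x∈p∪q⁻; q⊆p∪q; x∈p∧x∉q⇒x∈p─q; p─q⊆p; x∈∁p⇒x∉p; x∉p⇒x∈∁p; x∉∁p⇒x∈p)
open import Data.List using (_∷_; map; filter; allFin)
open import Data.List.Membership.Propositional using (lose) renaming (_∈_ to _∈ˡ_)
open import Data.List.Membership.Propositional.Properties
  using (∈-map⁺; ∈-map⁻; ∈-++⁺ˡ; ∈-++⁺ʳ; ∈-filter⁺; ∈-filter⁻; ∈-allFin; foldr-selective)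
open import Data.List.Properties using (foldr-preservesᵒ)
open import Data.List.Relation.Unary.Any using (Any; here; there; satisfied)
open import Data.List.Relation.Unary.Any.Properties using (any⁺; any⁻)
open import Data.Nat using (_⊓_; _≤ᵇ_)
open import Data.Nat.Properties
  using (module ≤-Reasoning; ≤-refl; ≤-trans; ≤-antisym; ≤ᵇ⇒≤; ≤⇒≤ᵇ; ⊓-sel; m≤n⇒m⊓o≤n; m≤n⇒o⊓m≤n)
open import Data.Product using (∃; _×_; _,_; proj₂)
open import Data.Sum using (_⊎_; inj₁; inj₂; [_,_]; [_,_]′)
open import Data.Vec using ([]; _∷_; tabulate; lookup; here; there)
open import Data.Vec.Properties using ([]=⇒lookup; lookup⇒[]=; lookup∘tabulate)
open import Function using (_∘_; id; Equivalence)
open import Relation.Binary.PropositionalEquality using (refl; sym; trans; cong; subst)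
open import Relation.Nullary.Decidable using (T?)

open Equivalence using (to; from)

T⇔T⇒≡ : ∀ {a b : Bool} → (T a → T b) → (T b → T a) → a ≡ b
T⇔T⇒≡ {false} {false} _ _   = refl
T⇔T⇒≡ {false} {true}  _ b⇒a = ⊥-elim (b⇒a _)
T⇔T⇒≡ {true}  {false} a⇒b _ = ⊥-elim (a⇒b _)
T⇔T⇒≡ {true}  {true}  _ _   = refl

module _ {n : ℕ} where

  x∈p⇒T[p!x] : ∀ {x : Fin n} {p : Subset n} → x ∈ p → T (lookup p x)
  x∈p⇒T[p!x] x∈p = from T-≡ ([]=⇒lookup x∈p)

  x∈tabulate⁺ : ∀ {f : Fin n → Bool} {x} → T (f x) → x ∈ tabulate f
  x∈tabulate⁺ {f} {x} fx = lookup⇒[]= x (tabulate f) (trans (lookup∘tabulate f x) (to T-≡ fx))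

  x∈tabulate⁻ : ∀ {f : Fin n → Bool} {x} → x ∈ tabulate f → T (f x)
  x∈tabulate⁻ {f} {x} x∈ = from T-≡ (trans (sym (lookup∘tabulate f x)) ([]=⇒lookup x∈))

x∈p─q⇒x∉q : ∀ {n} {x : Fin n} {p q : Subset n} → x ∈ p ─ q → x ∉ q
x∈p─q⇒x∉q {p = _ ∷ _} {false ∷ _} here ()
x∈p─q⇒x∉q {p = _ ∷ p} {_ ∷ q} (there x∈p─q) (there x∈q) = x∈p─q⇒x∉q {p = p} {q} x∈p─q x∈q

module _ {n : ℕ} (E : Graph n) where

  y∈nbhd⁺ : ∀ {A : Subset n} {x y} → x ∈ A → T (E x y) → y ∈ nbhd E A
  y∈nbhd⁺ {x = x} x∈A Exy =
    x∈tabulate⁺ (any⁺ _ (lose (∈-allFin x) (from T-∧ (x∈p⇒T[p!x] x∈A , Exy))))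

  y∈nbhd⁻ : ∀ {A : Subset n} {y} → y ∈ nbhd E A → ∃ λ x → x ∈ A × T (E x y)
  y∈nbhd⁻ {A} y∈ with satisfied (any⁻ _ (allFin n) (x∈tabulate⁻ y∈))
  ... | x , Ax∧Exy with to T-∧ Ax∧Exy
  ... | Ax , Exy = x , lookup⇒[]= x A (to T-≡ Ax) , Exy

  p⊆nbhd : Reflexive E → ∀ {A : Subset n} → A ⊆ nbhd E A
  p⊆nbhd refl-E {x = x} x∈A = y∈nbhd⁺ x∈A (from T-≡ (refl-E x))

  p∪nbhd≡nbhd : Reflexive E → ∀ (A : Subset n) → A ∪ nbhd E A ≡ nbhd E A
  p∪nbhd≡nbhd refl-E A =
    ⊆-antisym (λ x∈ → [ p⊆nbhd refl-E , id ] (x∈p∪q⁻ A (nbhd E A) x∈)) (q⊆p∪q A (nbhd E A))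

coNbhd : ∀ {n} → Graph n → Subset n → Subset n
coNbhd E X = ∁ (nbhd E X)

module _ {n : ℕ} (E : Graph n) (X : Subset n) where

  x∈X⇒x∉nbhd-rev-coNbhd : ∀ {x} → x ∈ X → x ∉ nbhd (rev E) (coNbhd E X)
  x∈X⇒x∉nbhd-rev-coNbhd x∈X x∈ with y∈nbhd⁻ (rev E) x∈
  ... | z , z∈Y , Exz = x∈∁p⇒x∉p z∈Y (y∈nbhd⁺ E x∈X Exz)

  p⊆coNbhd-rev-coNbhd : X ⊆ coNbhd (rev E) (coNbhd E X)
  p⊆coNbhd-rev-coNbhd = x∉p⇒x∈∁p ∘ x∈X⇒x∉nbhd-rev-coNbhd

  boundary-rev-coNbhd⊆boundary : boundary (rev E) (coNbhd E X) ⊆ boundary E X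
  boundary-rev-coNbhd⊆boundary y∈ =
    x∈p∧x∉q⇒x∈p─q (x∉∁p⇒x∈p (x∈p─q⇒x∉q y∈))
                  (λ y∈X → x∈X⇒x∉nbhd-rev-coNbhd y∈X (p─q⊆p _ _ y∈))

module _ {n : ℕ} (E : Graph n) (k : ℕ) where

  admissible⁻ : ∀ {X} → T (admissible E k X) → k ≤ ∣ X ∣ × k ≤ ∣ coNbhd E X ∣
  admissible⁻ adm with to T-∧ adm
  ... | k≤∣X∣ , k≤∣Y∣ = ≤ᵇ⇒≤ _ _ k≤∣X∣ , ≤ᵇ⇒≤ _ _ k≤∣Y∣

  admissible⁺ : ∀ {X} → k ≤ ∣ X ∣ → k ≤ ∣ coNbhd E X ∣ → T (admissible E k X)
  admissible⁺ k≤∣X∣ k≤∣Y∣ = from T-∧ (≤⇒≤ᵇ k≤∣X∣ , ≤⇒≤ᵇ k≤∣Y∣)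

admissible-rev-coNbhd : ∀ {n} (E : Graph n) k X →
                        T (admissible E k X) → T (admissible (rev E) k (coNbhd E X))
admissible-rev-coNbhd E k X adm with admissible⁻ E k {X} adm
... | k≤∣X∣ , k≤∣Y∣ =
  admissible⁺ (rev E) k {coNbhd E X} k≤∣Y∣ (≤-trans k≤∣X∣ (p⊆q⇒∣p∣≤∣q∣ (p⊆coNbhd-rev-coNbhd E X)))

∈-subsets : ∀ {n} (X : Subset n) → X ∈ˡ subsets n
∈-subsets []          = here refl
∈-subsets (true ∷ X)  = ∈-++⁺ˡ (∈-map⁺ (true ∷_) (∈-subsets X))
∈-subsets (false ∷ X) = ∈-++⁺ʳ (map (true ∷_) (subsets _)) (∈-map⁺ (false ∷_) (∈-subsets X))

module _ {n : ℕ} (E : Graph n) (refl-E : Reflexive E) (k : ℕ) where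

  inducesSep≡admissible : ∀ X → inducesSep E k X ≡ admissible E k X
  inducesSep≡admissible X = cong (λ N → (k ≤ᵇ ∣ X ∣) ∧ (k ≤ᵇ ∣ ∁ N ∣)) (p∪nbhd≡nbhd E refl-E X)

  separable⇒admissible : T (separable E k) → ∃ λ X → T (admissible E k X)
  separable⇒admissible sep with satisfied (any⁻ _ (subsets n) sep)
  ... | X , sepX = X , subst T (inducesSep≡admissible X) sepX

  admissible⇒separable : ∀ X → T (admissible E k X) → T (separable E k)
  admissible⇒separable X adm =
    any⁺ _ (lose (∈-subsets X) (subst T (sym (inducesSep≡admissible X)) adm))

separable⇒separable-rev : ∀ {n} (E : Graph n) → Reflexive E → ∀ k →
                          T (separable E k) → T (separable (rev E) k)
separable⇒separable-rev E refl-E k sep with separable⇒admissible E refl-E k sep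
... | X , adm = admissible⇒separable (rev E) refl-E k (coNbhd E X) (admissible-rev-coNbhd E k X adm)

separable≡separable-rev : ∀ {n} (E : Graph n) → Reflexive E → ∀ k → separable E k ≡ separable (rev E) k
separable≡separable-rev E refl-E k =
  T⇔T⇒≡ (separable⇒separable-rev E refl-E k) (separable⇒separable-rev (rev E) refl-E k)

minList-≤ : ∀ {xs y} → y ∈ˡ xs → minList xs ≤ y
minList-≤ {x ∷ xs} {y} y∈ = foldr-preservesᵒ ⊓-pres-≤y x xs (head-or-tail y∈)
  where
  ⊓-pres-≤y : ∀ a b → a ≤ y ⊎ b ≤ y → a ⊓ b ≤ y
  ⊓-pres-≤y a b = [ m≤n⇒m⊓o≤n b , m≤n⇒o⊓m≤n a ]
  head-or-tail : y ∈ˡ x ∷ xs → x ≤ y ⊎ Any (_≤ y) xs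
  head-or-tail (here refl)  = inj₁ ≤-refl
  head-or-tail (there y∈xs) = inj₂ (lose y∈xs ≤-refl)

-- The element y only witnesses that the list is nonempty (minList [] is a junk 0).
minList-∈ : ∀ {xs y} → y ∈ˡ xs → minList xs ∈ˡ xs
minList-∈ {x ∷ xs} _ = [ here , there ]′ (foldr-selective ⊓-sel x xs)

minBoundary : ∀ {n} → Graph n → ℕ → ℕ
minBoundary {n} E k =
  minList (map (λ X → ∣ boundary E X ∣) (filter (λ X → T? (admissible E k X)) (subsets n)))

module _ {n : ℕ} (E : Graph n) (k : ℕ) where

  minBoundary-≤ : ∀ X → T (admissible E k X) → minBoundary E k ≤ ∣ boundary E X ∣
  minBoundary-≤ X adm = minList-≤ (∈-map⁺ _ (∈-filter⁺ _ (∈-subsets X) adm))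

  minBoundary-attained : ∀ X → T (admissible E k X) →
                         ∃ λ Z → T (admissible E k Z) × minBoundary E k ≡ ∣ boundary E Z ∣
  minBoundary-attained X adm
    with ∈-map⁻ _ (minList-∈ (∈-map⁺ (λ X → ∣ boundary E X ∣) (∈-filter⁺ _ (∈-subsets X) adm)))
  ... | Z , Z∈ , min≡ =
    Z , proj₂ (∈-filter⁻ (λ X → T? (admissible E k X)) {xs = subsets n} Z∈) , min≡

minBoundary-rev≤minBoundary : ∀ {n} (E : Graph n) → Reflexive E → ∀ k → T (separable E k) →
                              minBoundary (rev E) k ≤ minBoundary E k
minBoundary-rev≤minBoundary E refl-E k sep with separable⇒admissible E refl-E k sep
... | X₀ , adm₀ with minBoundary-attained E k X₀ adm₀
... | X , adm , min≡ = begin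
  minBoundary (rev E) k              ≤⟨ minBoundary-≤ (rev E) k (coNbhd E X) (admissible-rev-coNbhd E k X adm) ⟩
  ∣ boundary (rev E) (coNbhd E X) ∣  ≤⟨ p⊆q⇒∣p∣≤∣q∣ (boundary-rev-coNbhd⊆boundary E X) ⟩
  ∣ boundary E X ∣                   ≡⟨ min≡ ⟨
  minBoundary E k                    ∎
  where open ≤-Reasoning

kappaNeg≤kappa : ∀ {n} (E : Graph n) → Reflexive E → ∀ k → kappaNeg E k ≤ kappa E k
kappaNeg≤kappa E refl-E k with separable E k in sep | separable (rev E) k | separable≡separable-rev E refl-E k
... | true  | .true  | refl = minBoundary-rev≤minBoundary E refl-E k (from T-≡ sep)
... | false | .false | refl = ≤-refl

-- The bounds on k only make the convention for non-separable graphs meaningful; the identity holds without them.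
lemma5 : (n : ℕ) (E : Graph n) → Reflexive E → (k : ℕ) → 1 ≤ k → 2 * k ∸ 1 ≤ n →
         kappa E k ≡ kappaNeg E k
lemma5 n E refl-E k _ _ = ≤-antisym (kappaNeg≤kappa (rev E) refl-E k) (kappaNeg≤kappa E refl-E k)
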